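{- Let $\mathcal M(q)=(\mathcal P,\mathcal Z)$ be a finite Möbius plane of order $q$ and let $B$ be a blocking set of $\mathcal M(q)$ of minimum cardinality. Then \[|B|<\frac{q^2+1}{q+1}\left(1+\log(q(q+1))\right).\]
   Context: A Möbius plane is a pair $(\mathcal P,\mathcal Z)$, where $\mathcal P$ is a set (of points) and $\mathcal Z$ is a set of subsets of $\mathcal P$ (circles), such that: (i) any three pairwise distinct points lie on exactly one circle; (ii) if $z\in\mathcal Z$, $P\in z$ and $Q\in\mathcal P\setminus z$, there is exactly one circle $z'$ through $P$ and $Q$ with $z\cap z'=\{P\}$; (iii) there is at least one circle and every circle has at least three points; (iv) for every circle $z$ there is a point not on $z$. It is finite if $\mathcal P$ is finite; then all circles have the same number $q+1$ of points, and $q$ is the order. A blocking set of the Möbius plane is a set $B\subseteq\mathcal P$ meeting every circle. Here $\log$ is the natural logarithm. -}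

module Defs where

open import Data.Nat as ℕ using (ℕ; zero; suc; _!)
open import Data.Nat.Properties using (_!≢0)
open import Data.Integer using (+_)
open import Data.Rational as ℚ using (ℚ; 0ℚ; 1ℚ; _/_)
open import Data.Fin using (Fin)
open import Data.Fin.Subset using (Subset; _∈_; _∉_; _∩_; ⁅_⁆; ∣_∣; Nonempty)
open import Data.Product using (Σ; ∃; ∃-syntax; _×_; _,_)
open import Relation.Binary.PropositionalEquality using (_≡_; _≢_)

record MobiusPlane : Set₁ where
  field
    n      : ℕ
    Circle : Subset n → Set
    ax1 : (P Q R : Fin n) → P ≢ Q → P ≢ R → Q ≢ R →
          Σ (Subset n) λ z → (Circle z × P ∈ z × Q ∈ z × R ∈ z) ×
            ((z' : Subset n) → Circle z' → P ∈ z' → Q ∈ z' → R ∈ z' → z' ≡ z)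
    ax2 : (z : Subset n) → Circle z → (P Q : Fin n) → P ∈ z → Q ∉ z →
          Σ (Subset n) λ z' → (Circle z' × P ∈ z' × Q ∈ z' × z ∩ z' ≡ ⁅ P ⁆) ×
            ((z'' : Subset n) → Circle z'' → P ∈ z'' → Q ∈ z'' → z ∩ z'' ≡ ⁅ P ⁆ → z'' ≡ z')
    ax3a : ∃[ z ] Circle z
    ax3b : (z : Subset n) → Circle z → 3 ℕ.≤ ∣ z ∣
    ax4 : (z : Subset n) → Circle z → ∃[ P ] P ∉ z

open MobiusPlane public

HasOrder : MobiusPlane → ℕ → Set
HasOrder M q = (z : Subset (n M)) → Circle M z → ∣ z ∣ ≡ suc q

IsBlockingSet : (M : MobiusPlane) → Subset (n M) → Set
IsBlockingSet M B = (z : Subset (n M)) → Circle M z → Nonempty (B ∩ z)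

IsMinimumBlockingSet : (M : MobiusPlane) → Subset (n M) → Set
IsMinimumBlockingSet M B =
  IsBlockingSet M B × ((B' : Subset (n M)) → IsBlockingSet M B' → ∣ B ∣ ℕ.≤ ∣ B' ∣)

powℚ : ℚ → ℕ → ℚ
powℚ x zero    = 1ℚ
powℚ x (suc k) = x ℚ.* powℚ x k

invFact : ℕ → ℚ
invFact k = + 1 / (k !)
  where instance _ = k !≢0

expPartial : ℚ → ℕ → ℚ
expPartial x zero    = 1ℚ
expPartial x (suc M) = expPartial x M ℚ.+ powℚ x (suc M) ℚ.* invFact (suc M)

-- For a ≥ 0 and c > 0 (the only case used), the real inequality
--   a < 1 + log c   ⟺   exp a < e · c,
-- with exp a = sup_M S_M(a) and e = sup_M S_M(1) (increasing limits):
--   exp a < e · c  ⟺  ∃ M₀, ε > 0 such that ∀ M, S_M(a) + ε ≤ c · S_{M₀}(1).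
_<1+log_ : ℚ → ℚ → Set
a <1+log c = ∃[ M₀ ] ∃[ ε ] (0ℚ ℚ.< ε ×
  ((M : ℕ) → expPartial a M ℚ.+ ε ℚ.≤ c ℚ.* expPartial 1ℚ M₀))

{-# OPTIONS --safe #-}

-- In a Möbius plane of order q every circle has q + 1 points, there are at most q² + 1
-- points, and two points lie on at most q + 1 common circles (by the touching axiom), so
-- every point lies on at most q (q + 1) circles. The greedy algorithm of Lovász and Stein,
-- which keeps choosing a point on the largest number of circles not yet met, then yields a
-- blocking set of size at most (q² + 1) / (q + 1) · H_(q(q+1)). Finally H_m < 1 + log m; in the
-- exponential-series form of _<1+log_ this is exp H_m ≤ (19/8) m < e · m, proved by induction
-- from exp (3/2) ≤ 19/4 and (1 - 1/(m + 1)) exp H_(m+1) ≤ exp H_m.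

module Submission where

open import Defs

module Exponential where

  open import Data.Nat as ℕ using (ℕ; zero; suc; _!; z≤n; s≤s; NonZero)
  import Data.Nat.Properties as ℕP
  open import Data.Nat.Tactic.RingSolver using (solve-∀)
  open import Data.Integer as ℤ using (+_)
  import Data.Integer.Properties as ℤP
  open import Data.Rational as ℚ using (ℚ; 0ℚ; 1ℚ; _+_; _*_; _-_; _≤_; _/_; -_; toℚᵘ)
  import Data.Rational.Properties as ℚP
  import Data.Rational.Unnormalised as ℚᵘ
  import Data.Rational.Unnormalised.Properties as ℚᵘP
  open import Data.Rational.Solver using (module +-*-Solver)
  open import Data.Product using (_,_)
  open import Relation.Binary.PropositionalEquality using (_≡_; refl; sym; trans; cong; cong₂; subst₂)

  fromℕ : ℕ → ℚ
  fromℕ n = + n / 1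

  -- + a / suc b is fromℚᵘ (mkℚᵘ (+ a) b) by definition.
  toℚᵘ-/ : ∀ a b → toℚᵘ (+ a / suc b) ℚᵘ.≃ ℚᵘ.mkℚᵘ (+ a) b
  toℚᵘ-/ a b = ℚP.toℚᵘ-fromℚᵘ (ℚᵘ.mkℚᵘ (+ a) b)

  a/b≤c/d : ∀ a b c d .{{_ : NonZero b}} .{{_ : NonZero d}} →
            a ℕ.* d ℕ.≤ c ℕ.* b → + a / b ℚ.≤ + c / d
  a/b≤c/d a (suc b) c (suc d) ad≤cb = ℚP.toℚᵘ-cancel-≤
    (ℚᵘP.≤-respˡ-≃ (ℚᵘP.≃-sym (toℚᵘ-/ a b)) (ℚᵘP.≤-respʳ-≃ (ℚᵘP.≃-sym (toℚᵘ-/ c d))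
      (ℚᵘ.*≤* (subst₂ ℤ._≤_ (ℤP.pos-* a (suc d)) (ℤP.pos-* c (suc b)) (ℤ.+≤+ ad≤cb)))))

  a/b≡c/d : ∀ a b c d .{{_ : NonZero b}} .{{_ : NonZero d}} →
            a ℕ.* d ≡ c ℕ.* b → + a / b ≡ + c / d
  a/b≡c/d a (suc b) c (suc d) ad≡cb = ℚP.toℚᵘ-injective
    (ℚᵘP.≃-trans (toℚᵘ-/ a b) (ℚᵘP.≃-trans
      (ℚᵘ.*≡* (trans (sym (ℤP.pos-* a (suc d))) (trans (cong +_ ad≡cb) (ℤP.pos-* c (suc b)))))
      (ℚᵘP.≃-sym (toℚᵘ-/ c d))))

  a/b+c/d : ∀ a b c d .{{_ : NonZero b}} .{{_ : NonZero d}} →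
            + a / b ℚ.+ + c / d ≡ (+ (a ℕ.* d ℕ.+ c ℕ.* b) / (b ℕ.* d)) {{ℕP.m*n≢0 b d}}
  a/b+c/d a b@(suc b-1) c d@(suc d-1) = ℚP.toℚᵘ-injective (begin
    toℚᵘ (+ a / b ℚ.+ + c / d)                    ≈⟨ ℚP.toℚᵘ-homo-+ (+ a / b) (+ c / d) ⟩
    toℚᵘ (+ a / b) ℚᵘ.+ toℚᵘ (+ c / d)            ≈⟨ ℚᵘP.+-cong (toℚᵘ-/ a b-1) (toℚᵘ-/ c d-1) ⟩
    ℚᵘ.mkℚᵘ (+ a) b-1 ℚᵘ.+ ℚᵘ.mkℚᵘ (+ c) d-1      ≡⟨ cong (λ x → ℚᵘ.mkℚᵘ x (ℕ.pred (b ℕ.* d))) numerator ⟩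
    ℚᵘ.mkℚᵘ (+ (a ℕ.* d ℕ.+ c ℕ.* b)) (ℕ.pred (b ℕ.* d)) ≈⟨ toℚᵘ-/ _ _ ⟨
    toℚᵘ (+ (a ℕ.* d ℕ.+ c ℕ.* b) / (b ℕ.* d))   ∎)
    where
    open ℚᵘP.≃-Reasoning
    numerator : + a ℤ.* + d ℤ.+ + c ℤ.* + b ≡ + (a ℕ.* d ℕ.+ c ℕ.* b)
    numerator = trans (cong₂ ℤ._+_ (sym (ℤP.pos-* a d)) (sym (ℤP.pos-* c b))) (sym (ℤP.pos-+ (a ℕ.* d) (c ℕ.* b)))

  a/b*c/d : ∀ a b c d .{{_ : NonZero b}} .{{_ : NonZero d}} →
            (+ a / b) ℚ.* (+ c / d) ≡ (+ (a ℕ.* c) / (b ℕ.* d)) {{ℕP.m*n≢0 b d}}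
  a/b*c/d a b@(suc b-1) c d@(suc d-1) = ℚP.toℚᵘ-injective (begin
    toℚᵘ ((+ a / b) ℚ.* (+ c / d))                ≈⟨ ℚP.toℚᵘ-homo-* (+ a / b) (+ c / d) ⟩
    toℚᵘ (+ a / b) ℚᵘ.* toℚᵘ (+ c / d)            ≈⟨ ℚᵘP.*-cong (toℚᵘ-/ a b-1) (toℚᵘ-/ c d-1) ⟩
    ℚᵘ.mkℚᵘ (+ a) b-1 ℚᵘ.* ℚᵘ.mkℚᵘ (+ c) d-1      ≡⟨ cong (λ x → ℚᵘ.mkℚᵘ x (ℕ.pred (b ℕ.* d))) (sym (ℤP.pos-* a c)) ⟩
    ℚᵘ.mkℚᵘ (+ (a ℕ.* c)) (ℕ.pred (b ℕ.* d))      ≈⟨ toℚᵘ-/ _ _ ⟨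
    toℚᵘ (+ (a ℕ.* c) / (b ℕ.* d))               ∎)
    where open ℚᵘP.≃-Reasoning

  open +-*-Solver
  open ℚP.≤-Reasoning

  *-monoˡ-≤-≥0 : ∀ {r p q} → 0ℚ ≤ r → p ≤ q → r * p ≤ r * q
  *-monoˡ-≤-≥0 {r} 0≤r = ℚP.*-monoˡ-≤-nonNeg r {{ℚ.nonNegative 0≤r}}

  *-monoʳ-≤-≥0 : ∀ {r p q} → 0ℚ ≤ r → p ≤ q → p * r ≤ q * r
  *-monoʳ-≤-≥0 {r} 0≤r = ℚP.*-monoʳ-≤-nonNeg r {{ℚ.nonNegative 0≤r}}

  *-≥0 : ∀ {p q} → 0ℚ ≤ p → 0ℚ ≤ q → 0ℚ ≤ p * q
  *-≥0 {p} 0≤p 0≤q = ℚP.≤-trans (ℚP.≤-reflexive (sym (ℚP.*-zeroʳ p))) (*-monoˡ-≤-≥0 0≤p 0≤q)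

  p≤p+q : ∀ {p q} → 0ℚ ≤ q → p ≤ p + q
  p≤p+q {p} 0≤q = ℚP.≤-trans (ℚP.≤-reflexive (sym (ℚP.+-identityʳ p))) (ℚP.+-monoʳ-≤ p 0≤q)

  +-cancelʳ-≤ : ∀ {p q r} → p + r ≤ q + r → p ≤ q
  +-cancelʳ-≤ {p} {q} {r} p+r≤q+r = begin
    p           ≡⟨ solve 2 (λ p r → p := p :+ r :- r) refl p r ⟩
    p + r - r   ≤⟨ ℚP.+-monoˡ-≤ (- r) p+r≤q+r ⟩
    q + r - r   ≡⟨ solve 2 (λ q r → q :+ r :- r := q) refl q r ⟩
    q           ∎

  fromℕ-suc : ∀ n → fromℕ (suc n) ≡ 1ℚ + fromℕ n
  fromℕ-suc n = sym (trans (a/b+c/d 1 1 n 1) (a/b≡c/d (1 ℕ.* 1 ℕ.+ n ℕ.* 1) (1 ℕ.* 1) (suc n) 1 (identity n)))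
    where
    identity : ∀ n → (1 ℕ.* 1 ℕ.+ n ℕ.* 1) ℕ.* 1 ≡ suc n ℕ.* (1 ℕ.* 1)
    identity = solve-∀

  fromℕ-mono-≤ : ∀ {m n} → m ℕ.≤ n → fromℕ m ≤ fromℕ n
  fromℕ-mono-≤ {m} {n} m≤n = a/b≤c/d m 1 n 1 (ℕP.*-monoˡ-≤ 1 m≤n)

  fromℕ-≥0 : ∀ n → 0ℚ ≤ fromℕ n
  fromℕ-≥0 n = fromℕ-mono-≤ {0} {n} z≤n

  fromℕ-suc-positive : ∀ n → ℚ.Positive (fromℕ (suc n))
  fromℕ-suc-positive n = ℚP.normalize-pos (suc n) 1

  invFact-≥0 : ∀ k → 0ℚ ≤ invFact k
  invFact-≥0 k = a/b≤c/d 0 1 1 (k !) {{_}} {{k ℕP.!≢0}} z≤n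

  fromℕ-suc*invFact-suc : ∀ k → fromℕ (suc k) * invFact (suc k) ≡ invFact k
  fromℕ-suc*invFact-suc k =
    trans (a/b*c/d (suc k) 1 1 (suc k !) {{_}} {{suc k ℕP.!≢0}})
          (a/b≡c/d _ _ 1 (k !) {{ℕP.m*n≢0 1 (suc k !) {{_}} {{suc k ℕP.!≢0}}}} {{k ℕP.!≢0}} (identity (suc k) (k !)))
    where
    identity : ∀ s f → s ℕ.* 1 ℕ.* f ≡ 1 ℕ.* (1 ℕ.* (s ℕ.* f))
    identity = solve-∀

  expTerm : ℚ → ℕ → ℚ
  expTerm x k = powℚ x k * invFact k

  pow-≥0 : ∀ {x} → 0ℚ ≤ x → ∀ j → 0ℚ ≤ powℚ x j
  pow-≥0 0≤x zero    = fromℕ-≥0 1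
  pow-≥0 0≤x (suc j) = *-≥0 0≤x (pow-≥0 0≤x j)

  pow-mono-≤ : ∀ {x y} → 0ℚ ≤ x → x ≤ y → ∀ j → powℚ x j ≤ powℚ y j
  pow-mono-≤ 0≤x x≤y zero    = ℚP.≤-refl
  pow-mono-≤ {x} {y} 0≤x x≤y (suc j) = begin
    x * powℚ x j ≤⟨ *-monoʳ-≤-≥0 (pow-≥0 0≤x j) x≤y ⟩
    y * powℚ x j ≤⟨ *-monoˡ-≤-≥0 (ℚP.≤-trans 0≤x x≤y) (pow-mono-≤ 0≤x x≤y j) ⟩
    y * powℚ y j ∎

  expTerm-≥0 : ∀ {x} → 0ℚ ≤ x → ∀ k → 0ℚ ≤ expTerm x k
  expTerm-≥0 0≤x k = *-≥0 (pow-≥0 0≤x k) (invFact-≥0 k)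

  expTerm-mono-≤ : ∀ {x y} → 0ℚ ≤ x → x ≤ y → ∀ k → expTerm x k ≤ expTerm y k
  expTerm-mono-≤ 0≤x x≤y k = *-monoʳ-≤-≥0 (invFact-≥0 k) (pow-mono-≤ 0≤x x≤y k)

  fromℕ-suc*expTerm-suc : ∀ x k → fromℕ (suc k) * expTerm x (suc k) ≡ x * expTerm x k
  fromℕ-suc*expTerm-suc x k = begin-equality
    c * (x * powℚ x k * invFact (suc k))
      ≡⟨ solve 4 (λ c x p i → c :* (x :* p :* i) := x :* p :* (c :* i)) refl c x (powℚ x k) (invFact (suc k)) ⟩
    x * powℚ x k * (c * invFact (suc k))
      ≡⟨ cong (x * powℚ x k *_) (fromℕ-suc*invFact-suc k) ⟩
    x * powℚ x k * invFact k
      ≡⟨ ℚP.*-assoc x (powℚ x k) (invFact k) ⟩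
    x * expTerm x k ∎
    where
    c : ℚ
    c = fromℕ (suc k)

  pow-suc-mean-value : ∀ {x d} → 0ℚ ≤ x → 0ℚ ≤ d → ∀ j →
    powℚ (x + d) (suc j) ≤ powℚ x (suc j) + fromℕ (suc j) * d * powℚ (x + d) j
  pow-suc-mean-value {x} {d} 0≤x 0≤d zero = ℚP.≤-reflexive
    (solve 2 (λ x d → (x :+ d) :* con 1ℚ := x :* con 1ℚ :+ con 1ℚ :* d :* con 1ℚ) refl x d)
  pow-suc-mean-value {x} {d} 0≤x 0≤d (suc j) = begin
    y * powℚ y (suc j)
      ≤⟨ *-monoˡ-≤-≥0 0≤y (pow-suc-mean-value 0≤x 0≤d j) ⟩
    y * (X + c * d * powℚ y j)
      ≡⟨ solve 5 (λ x d X P c → (x :+ d) :* (X :+ c :* d :* P) := x :* X :+ d :* X :+ c :* d :* ((x :+ d) :* P)) refl x d X (powℚ y j) c ⟩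
    x * X + d * X + c * d * powℚ y (suc j)
      ≤⟨ ℚP.+-monoˡ-≤ _ (ℚP.+-monoʳ-≤ (x * X) (*-monoˡ-≤-≥0 0≤d (pow-mono-≤ 0≤x (p≤p+q 0≤d) (suc j)))) ⟩
    x * X + d * powℚ y (suc j) + c * d * powℚ y (suc j)
      ≡⟨ solve 5 (λ x X d Y c → x :* X :+ d :* Y :+ c :* d :* Y := x :* X :+ (con 1ℚ :+ c) :* d :* Y) refl x X d (powℚ y (suc j)) c ⟩
    x * X + (1ℚ + c) * d * powℚ y (suc j)
      ≡⟨ cong (λ c → x * X + c * d * powℚ y (suc j)) (sym (fromℕ-suc (suc j))) ⟩
    x * X + fromℕ (suc (suc j)) * d * powℚ y (suc j) ∎
    where
    y X c : ℚ
    y = x + d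
    X = powℚ x (suc j)
    c = fromℕ (suc j)
    0≤y : 0ℚ ≤ y
    0≤y = ℚP.+-mono-≤ 0≤x 0≤d

  expTerm-suc-mean-value : ∀ {x d} → 0ℚ ≤ x → 0ℚ ≤ d → ∀ j →
    expTerm (x + d) (suc j) ≤ expTerm x (suc j) + d * expTerm (x + d) j
  expTerm-suc-mean-value {x} {d} 0≤x 0≤d j = begin
    powℚ y (suc j) * i
      ≤⟨ *-monoʳ-≤-≥0 (invFact-≥0 (suc j)) (pow-suc-mean-value 0≤x 0≤d j) ⟩
    (powℚ x (suc j) + c * d * powℚ y j) * i
      ≡⟨ solve 5 (λ X c d P i → (X :+ c :* d :* P) :* i := X :* i :+ d :* (P :* (c :* i))) refl (powℚ x (suc j)) c d (powℚ y j) i ⟩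
    expTerm x (suc j) + d * (powℚ y j * (c * i))
      ≡⟨ cong (λ t → expTerm x (suc j) + d * (powℚ y j * t)) (fromℕ-suc*invFact-suc j) ⟩
    expTerm x (suc j) + d * expTerm y j ∎
    where
    y c i : ℚ
    y = x + d
    c = fromℕ (suc j)
    i = invFact (suc j)

  expPartial-≥0 : ∀ {x} → 0ℚ ≤ x → ∀ M → 0ℚ ≤ expPartial x M
  expPartial-≥0 0≤x zero    = fromℕ-≥0 1
  expPartial-≥0 0≤x (suc M) = ℚP.+-mono-≤ (expPartial-≥0 0≤x M) (expTerm-≥0 0≤x (suc M))

  expPartial-≤-suc : ∀ {x} → 0ℚ ≤ x → ∀ M → expPartial x M ≤ expPartial x (suc M)
  expPartial-≤-suc 0≤x M = p≤p+q (expTerm-≥0 0≤x (suc M))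

  expPartial-mono-≤ : ∀ {x y} → 0ℚ ≤ x → x ≤ y → ∀ M → expPartial x M ≤ expPartial y M
  expPartial-mono-≤ 0≤x x≤y zero    = ℚP.≤-refl
  expPartial-mono-≤ 0≤x x≤y (suc M) =
    ℚP.+-mono-≤ (expPartial-mono-≤ 0≤x x≤y M) (expTerm-mono-≤ 0≤x x≤y (suc M))

  expPartial-suc-mean-value : ∀ {x d} → 0ℚ ≤ x → 0ℚ ≤ d → ∀ M →
    expPartial (x + d) (suc M) ≤ expPartial x (suc M) + d * expPartial (x + d) M
  expPartial-suc-mean-value {x} {d} 0≤x 0≤d zero = begin
    1ℚ + expTerm y 1
      ≤⟨ ℚP.+-monoʳ-≤ 1ℚ (expTerm-suc-mean-value 0≤x 0≤d 0) ⟩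
    1ℚ + (expTerm x 1 + d * expTerm y 0)
      ≡⟨ solve 3 (λ X d T → con 1ℚ :+ (X :+ d :* T) := con 1ℚ :+ X :+ d :* T) refl (expTerm x 1) d (expTerm y 0) ⟩
    1ℚ + expTerm x 1 + d * 1ℚ ∎
    where
    y : ℚ
    y = x + d
  expPartial-suc-mean-value {x} {d} 0≤x 0≤d (suc M) = begin
    expPartial y (suc M) + expTerm y (suc (suc M))
      ≤⟨ ℚP.+-mono-≤ (expPartial-suc-mean-value 0≤x 0≤d M) (expTerm-suc-mean-value 0≤x 0≤d (suc M)) ⟩
    (expPartial x (suc M) + d * expPartial y M) + (expTerm x (suc (suc M)) + d * expTerm y (suc M))
      ≡⟨ solve 5 (λ A d B X Y → (A :+ d :* B) :+ (X :+ d :* Y) := (A :+ X) :+ d :* (B :+ Y)) refl (expPartial x (suc M)) d (expPartial y M) (expTerm x (suc (suc M))) (expTerm y (suc M)) ⟩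
    expPartial x (suc (suc M)) + d * expPartial y (suc M) ∎
    where
    y : ℚ
    y = x + d

  expPartial-mean-value : ∀ {x d} → 0ℚ ≤ x → 0ℚ ≤ d → ∀ M →
    expPartial (x + d) M ≤ expPartial x M + d * expPartial (x + d) M
  expPartial-mean-value {x} {d} 0≤x 0≤d zero = p≤p+q (*-≥0 0≤d (fromℕ-≥0 1))
  expPartial-mean-value {x} {d} 0≤x 0≤d (suc M) = begin
    expPartial y (suc M)
      ≤⟨ expPartial-suc-mean-value 0≤x 0≤d M ⟩
    expPartial x (suc M) + d * expPartial y M
      ≤⟨ ℚP.+-monoʳ-≤ (expPartial x (suc M)) (*-monoˡ-≤-≥0 0≤d (expPartial-≤-suc 0≤y M)) ⟩
    expPartial x (suc M) + d * expPartial y (suc M) ∎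
    where
    y : ℚ
    y = x + d
    0≤y : 0ℚ ≤ y
    0≤y = ℚP.+-mono-≤ 0≤x 0≤d

  expTerm-suc-halves : ∀ {x k} → 0ℚ ≤ x → x + x ≤ fromℕ (suc k) →
    expTerm x (suc k) + expTerm x (suc k) ≤ expTerm x k
  expTerm-suc-halves {x} {k} 0≤x 2x≤c = ℚP.*-cancelˡ-≤-pos c {{fromℕ-suc-positive k}} (begin
    c * (t′ + t′)       ≡⟨ ℚP.*-distribˡ-+ c t′ t′ ⟩
    c * t′ + c * t′     ≡⟨ cong (λ u → u + u) (fromℕ-suc*expTerm-suc x k) ⟩
    x * t + x * t       ≡⟨ ℚP.*-distribʳ-+ t x x ⟨
    (x + x) * t         ≤⟨ *-monoʳ-≤-≥0 (expTerm-≥0 0≤x k) 2x≤c ⟩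
    c * t               ∎)
    where
    c t t′ : ℚ
    c = fromℕ (suc k)
    t = expTerm x k
    t′ = expTerm x (suc k)

  -- 19/4 = S₂(3/2) + t₂(3/2), and from t₂ on each term of the series of exp (3/2) at most
  -- halves the previous one.
  expPartial-3/2-tail : ∀ M →
    expPartial (+ 3 / 2) (suc (suc M)) + expTerm (+ 3 / 2) (suc (suc M)) ≤ + 19 / 4
  expPartial-3/2-tail zero    = ℚP.≤-refl
  expPartial-3/2-tail (suc M) = begin
    S + t′ + t′    ≡⟨ ℚP.+-assoc S t′ t′ ⟩
    S + (t′ + t′)  ≤⟨ ℚP.+-monoʳ-≤ S (expTerm-suc-halves {k = suc (suc M)} 0≤3/2 (fromℕ-mono-≤ (ℕP.m≤m+n 3 M))) ⟩
    S + expTerm (+ 3 / 2) (suc (suc M)) ≤⟨ expPartial-3/2-tail M ⟩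
    + 19 / 4       ∎
    where
    S t′ : ℚ
    S = expPartial (+ 3 / 2) (suc (suc M))
    t′ = expTerm (+ 3 / 2) (suc (suc (suc M)))
    0≤3/2 : 0ℚ ≤ + 3 / 2
    0≤3/2 = a/b≤c/d 0 1 3 2 z≤n

  expPartial-3/2-≤ : ∀ M → expPartial (+ 3 / 2) M ≤ + 19 / 4
  expPartial-3/2-≤ M = begin
    expPartial y M                   ≤⟨ expPartial-≤-suc 0≤y M ⟩
    expPartial y (suc M)             ≤⟨ expPartial-≤-suc 0≤y (suc M) ⟩
    expPartial y (suc (suc M))       ≤⟨ p≤p+q (expTerm-≥0 0≤y (suc (suc M))) ⟩
    expPartial y (suc (suc M)) + expTerm y (suc (suc M)) ≤⟨ expPartial-3/2-tail M ⟩
    + 19 / 4                         ∎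
    where
    y : ℚ
    y = + 3 / 2
    0≤y : 0ℚ ≤ y
    0≤y = a/b≤c/d 0 1 3 2 z≤n

  harmonic : ℕ → ℚ
  harmonic zero    = 0ℚ
  harmonic (suc j) = harmonic j + + 1 / suc j

  harmonic-≥0 : ∀ j → 0ℚ ≤ harmonic j
  harmonic-≥0 zero    = ℚP.≤-refl
  harmonic-≥0 (suc j) = ℚP.+-mono-≤ (harmonic-≥0 j) (a/b≤c/d 0 1 1 (suc j) z≤n)

  fromℕ*1/fromℕ : ∀ n → fromℕ (suc n) * (+ 1 / suc n) ≡ 1ℚ
  fromℕ*1/fromℕ n = trans (a/b*c/d (suc n) 1 1 (suc n)) (a/b≡c/d (suc n ℕ.* 1) (1 ℕ.* suc n) 1 1 (identity (suc n)))
    where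
    identity : ∀ s → s ℕ.* 1 ℕ.* 1 ≡ 1 ℕ.* (1 ℕ.* s)
    identity = solve-∀

  -- The base case is H₂ = 3/2; the step is (1 - 1/c) exp H_c ≤ exp H_c′ for c = c′ + 1,
  -- i.e. c′ A ≤ c B below.
  expPartial-harmonic-≤ : ∀ m M →
    expPartial (harmonic (suc (suc m))) M ≤ fromℕ (suc (suc m)) * (+ 19 / 8)
  expPartial-harmonic-≤ zero    M = expPartial-3/2-≤ M
  expPartial-harmonic-≤ (suc m) M = ℚP.*-cancelˡ-≤-pos c′ {{fromℕ-suc-positive (suc m)}} (+-cancelʳ-≤ (begin
    c′ * A + A
      ≡⟨ solve 2 (λ c′ A → c′ :* A :+ A := (con 1ℚ :+ c′) :* A) refl c′ A ⟩
    (1ℚ + c′) * A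
      ≡⟨ cong (_* A) (fromℕ-suc (suc (suc m))) ⟨
    c * A
      ≤⟨ *-monoˡ-≤-≥0 (fromℕ-≥0 (suc (suc (suc m)))) (expPartial-mean-value (harmonic-≥0 (suc (suc m))) 0≤d M) ⟩
    c * (B + d * A)
      ≡⟨ solve 4 (λ c B d A → c :* (B :+ d :* A) := c :* B :+ (c :* d) :* A) refl c B d A ⟩
    c * B + (c * d) * A
      ≡⟨ cong (λ u → c * B + u * A) (fromℕ*1/fromℕ (suc (suc m))) ⟩
    c * B + 1ℚ * A
      ≤⟨ ℚP.+-monoˡ-≤ (1ℚ * A) (*-monoˡ-≤-≥0 (fromℕ-≥0 (suc (suc (suc m)))) (expPartial-harmonic-≤ m M)) ⟩
    c * (c′ * K) + 1ℚ * A
      ≡⟨ solve 4 (λ c c′ K A → c :* (c′ :* K) :+ con 1ℚ :* A := c′ :* (c :* K) :+ A) refl c c′ K A ⟩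
    c′ * (c * K) + A ∎))
    where
    c c′ d K A B : ℚ
    c = fromℕ (suc (suc (suc m)))
    c′ = fromℕ (suc (suc m))
    d = + 1 / suc (suc (suc m))
    K = + 19 / 8
    A = expPartial (harmonic (suc (suc (suc m)))) M
    B = expPartial (harmonic (suc (suc m))) M
    0≤d : 0ℚ ≤ d
    0≤d = a/b≤c/d 0 1 1 (suc (suc (suc m))) z≤n

  -- 19/8 < 8/3 = S₃(1) ≤ e: the margin 7/24 leaves room for ε = 1/4.
  ≤harmonic⇒<1+log : ∀ m {a} → 0ℚ ≤ a → a ≤ harmonic (suc (suc m)) → a <1+log fromℕ (suc (suc m))
  ≤harmonic⇒<1+log m {a} 0≤a a≤H = 3 , + 1 / 4 , ℚP.positive⁻¹ (+ 1 / 4) , λ M → begin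
    expPartial a M + + 1 / 4
      ≤⟨ ℚP.+-monoˡ-≤ (+ 1 / 4) (ℚP.≤-trans (expPartial-mono-≤ 0≤a a≤H M) (expPartial-harmonic-≤ m M)) ⟩
    c * K + + 1 / 4
      ≤⟨ ℚP.+-monoʳ-≤ (c * K) (a/b≤c/d 1 4 7 24 (ℕP.m≤m+n 24 4)) ⟩
    c * K + 1ℚ * (+ 7 / 24)
      ≤⟨ ℚP.+-monoʳ-≤ (c * K) (*-monoʳ-≤-≥0 (a/b≤c/d 0 1 7 24 z≤n) (fromℕ-mono-≤ {1} {suc (suc m)} (s≤s z≤n))) ⟩
    c * K + c * (+ 7 / 24)
      ≡⟨ ℚP.*-distribˡ-+ c K (+ 7 / 24) ⟨
    c * expPartial 1ℚ 3 ∎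
    where
    c K : ℚ
    c = fromℕ (suc (suc m))
    K = + 19 / 8

open import Data.Nat using (ℕ; zero; suc; _+_; _*_; _≤_; _<_; z≤n; s≤s; _!; _≤?_; pred; NonZero)
import Data.Nat.Properties as ℕP
open import Data.Nat.Tactic.RingSolver using (solve-∀)
open import Data.Bool using (if_then_else_) renaming (_≟_ to _≟ᵇ_)
open import Data.Fin using (Fin; zero; suc; _≟_)
open import Data.Fin.Properties using (any?)
open import Data.Fin.Subset using (Subset; ∣_∣; _∈_; _∉_; _⊆_; _∪_; _∩_; ⁅_⁆; ⊥; Nonempty; inside; outside)
open import Data.Fin.Subset.Properties
  using (_∈?_; x∈p∪q⁺; x∈p∩q⁺; x∈p∩q⁻; x∈⁅x⁆; x∈⁅y⁆⇒x≡y; ⊆-antisym; ∣⊥∣≡0; ∣⁅x⁆∣≡1;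
         ∪-identityˡ; ∪-identityʳ; ∪-assoc; q⊆p∪q)
open import Data.Vec using ([]; _∷_)
open import Data.Vec.Properties using (≡-dec; ∷-injectiveʳ)
open import Data.Product using (Σ; ∃; _×_; _,_; proj₁; proj₂)
open import Data.Sum using (_⊎_; inj₁; inj₂)
open import Data.Empty using (⊥-elim)
open import Function using (_∘_; case_of_)
open import Level using (Level)
open import Relation.Nullary using (Dec; does; yes; no; ¬_; ¬?; contradiction)
open import Relation.Nullary.Decidable using (dec-true; map′; _×-dec_)
open import Relation.Unary using (Decidable)
open import Relation.Binary.PropositionalEquality
open import Algebra.Properties.Semiring.Sum ℕP.+-*-semiring
  using (sum; sum-cong-≗; ∑-distrib-+; *-distribˡ-sum; *-distribʳ-sum)
open import Algebra.Properties.CommutativeSemigroup ℕP.+-commutativeSemigroup using (interchange)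

-- Indicators and finite sums

private variable
  a : Level
  A : Set a

-- Defined through does, so that it computes through Dec.map′: 𝟙 (suc i ≟ suc j) reduces to
-- 𝟙 (i ≟ j), and 𝟙 (suc i ∈? s ∷ p) to 𝟙 (i ∈? p).
𝟙 : Dec A → ℕ
𝟙 a? = if does a? then 1 else 0

𝟙≤1 : (a? : Dec A) → 𝟙 a? ≤ 1
𝟙≤1 (yes _) = s≤s z≤n
𝟙≤1 (no _)  = z≤n

𝟙-yes : (a? : Dec A) → A → 𝟙 a? ≡ 1
𝟙-yes a? a rewrite dec-true a? a = refl

𝟙-witness : (a? : Dec A) → 0 < 𝟙 a? → A
𝟙-witness (yes a) _ = a

𝟙¬+𝟙≡1 : (a? : Dec A) → 𝟙 (¬? a?) + 𝟙 a? ≡ 1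
𝟙¬+𝟙≡1 (yes _) = refl
𝟙¬+𝟙≡1 (no _)  = refl

m*𝟙≤m : ∀ m (a? : Dec A) → m * 𝟙 a? ≤ m
m*𝟙≤m m a? = ℕP.≤-trans (ℕP.*-monoʳ-≤ m (𝟙≤1 a?)) (ℕP.≤-reflexive (ℕP.*-identityʳ m))

*-pos⁻¹ : ∀ m {n} → 0 < m * n → 0 < m × 0 < n
*-pos⁻¹ (suc m) {suc n} _      = s≤s z≤n , s≤s z≤n
*-pos⁻¹ (suc m) {zero}  0<m*0 = ⊥-elim (ℕP.n≮0 (subst (0 <_) (ℕP.*-zeroʳ m) 0<m*0))

*-congˡ-pos : ∀ m {a b} → (0 < m → a ≡ b) → m * a ≡ m * b
*-congˡ-pos zero    _   = refl
*-congˡ-pos (suc m) a≡b = cong (suc m *_) (a≡b (s≤s z≤n))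

*-monoʳ-≤-pos : ∀ m {a b} → (0 < m → a ≤ b) → m * a ≤ m * b
*-monoʳ-≤-pos zero    _   = z≤n
*-monoʳ-≤-pos (suc m) a≤b = ℕP.*-monoʳ-≤ (suc m) (a≤b (s≤s z≤n))

sum-mono-≤ : ∀ {n} {f g : Fin n → ℕ} → (∀ i → f i ≤ g i) → sum f ≤ sum g
sum-mono-≤ {zero}  f≤g = z≤n
sum-mono-≤ {suc n} f≤g = ℕP.+-mono-≤ (f≤g zero) (sum-mono-≤ (λ i → f≤g (suc i)))

sum-const : ∀ n c → sum {n} (λ _ → c) ≡ n * c
sum-const zero    c = refl
sum-const (suc n) c = cong (c +_) (sum-const n c)

f≤sum : ∀ {n} (f : Fin n → ℕ) i → f i ≤ sum f
f≤sum f zero    = ℕP.m≤m+n (f zero) _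
f≤sum f (suc i) = ℕP.≤-trans (f≤sum (λ j → f (suc j)) i) (ℕP.m≤n+m _ (f zero))

sum-pos⇒∃ : ∀ {n} (f : Fin n → ℕ) → 0 < sum f → ∃ λ i → 0 < f i
sum-pos⇒∃ {suc n} f 0<∑f with f zero in eq
... | suc _ = zero , subst (0 <_) (sym eq) (s≤s z≤n)
... | zero with sum-pos⇒∃ (λ i → f (suc i)) 0<∑f
...   | i , 0<fi = suc i , 0<fi

sum-split : ∀ {n} i (f : Fin n → ℕ) → sum f ≡ f i + sum (λ j → 𝟙 (¬? (i ≟ j)) * f j)
sum-split zero    f = cong (f zero +_) (sum-cong-≗ λ j → sym (ℕP.+-identityʳ (f (suc j))))
sum-split (suc i) f = begin
  f zero + sum (λ j → f (suc j))                                  ≡⟨ cong (f zero +_) (sum-split i (λ j → f (suc j))) ⟩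
  f zero + (f (suc i) + sum (λ j → 𝟙 (¬? (i ≟ j)) * f (suc j)))  ≡⟨ identity (f zero) (f (suc i)) _ ⟩
  f (suc i) + (1 * f zero + sum (λ j → 𝟙 (¬? (i ≟ j)) * f (suc j))) ∎
  where
  open ≡-Reasoning
  identity : ∀ a b c → a + (b + c) ≡ b + (1 * a + c)
  identity = solve-∀

sum-split₂ : ∀ {n} {i j} → i ≢ j → (f : Fin n → ℕ) →
  sum f ≡ f i + f j + sum (λ k → 𝟙 (¬? (i ≟ k)) * 𝟙 (¬? (j ≟ k)) * f k)
sum-split₂ {i = i} {j} i≢j f = begin
  sum f                                                        ≡⟨ sum-split i f ⟩
  f i + sum (λ k → 𝟙 (¬? (i ≟ k)) * f k)                       ≡⟨ cong (f i +_) (sum-split j (λ k → 𝟙 (¬? (i ≟ k)) * f k)) ⟩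
  f i + (𝟙 (¬? (i ≟ j)) * f j + sum (λ k → 𝟙 (¬? (j ≟ k)) * (𝟙 (¬? (i ≟ k)) * f k)))
    ≡⟨ cong (λ c → f i + (c * f j + sum (λ k → 𝟙 (¬? (j ≟ k)) * (𝟙 (¬? (i ≟ k)) * f k)))) (𝟙-yes (¬? (i ≟ j)) i≢j) ⟩
  f i + (1 * f j + sum (λ k → 𝟙 (¬? (j ≟ k)) * (𝟙 (¬? (i ≟ k)) * f k)))
    ≡⟨ identity (f i) (f j) (sum (λ k → 𝟙 (¬? (j ≟ k)) * (𝟙 (¬? (i ≟ k)) * f k))) ⟩
  f i + f j + sum (λ k → 𝟙 (¬? (j ≟ k)) * (𝟙 (¬? (i ≟ k)) * f k))
    ≡⟨ cong (f i + f j +_) (sum-cong-≗ λ k → identity′ (𝟙 (¬? (j ≟ k))) (𝟙 (¬? (i ≟ k))) (f k)) ⟩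
  f i + f j + sum (λ k → 𝟙 (¬? (i ≟ k)) * 𝟙 (¬? (j ≟ k)) * f k) ∎
  where
  open ≡-Reasoning
  identity : ∀ a b c → a + (1 * b + c) ≡ a + b + c
  identity = solve-∀
  identity′ : ∀ a b c → a * (b * c) ≡ b * a * c
  identity′ = solve-∀

∣p∣≡sum𝟙∈ : ∀ {n} (p : Subset n) → ∣ p ∣ ≡ sum (λ i → 𝟙 (i ∈? p))
∣p∣≡sum𝟙∈ []            = refl
∣p∣≡sum𝟙∈ (inside ∷ p)  = cong suc (∣p∣≡sum𝟙∈ p)
∣p∣≡sum𝟙∈ (outside ∷ p) = ∣p∣≡sum𝟙∈ p

∑ₛ : ∀ {n} → (Subset n → ℕ) → ℕ
∑ₛ {zero}  f = f []
∑ₛ {suc n} f = ∑ₛ (f ∘ (outside ∷_)) + ∑ₛ (f ∘ (inside ∷_))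

∑ₛ-cong : ∀ {n} {f g : Subset n → ℕ} → (∀ p → f p ≡ g p) → ∑ₛ f ≡ ∑ₛ g
∑ₛ-cong {zero}  f≡g = f≡g []
∑ₛ-cong {suc n} f≡g = cong₂ _+_ (∑ₛ-cong (f≡g ∘ (outside ∷_))) (∑ₛ-cong (f≡g ∘ (inside ∷_)))

∑ₛ-mono-≤ : ∀ {n} {f g : Subset n → ℕ} → (∀ p → f p ≤ g p) → ∑ₛ f ≤ ∑ₛ g
∑ₛ-mono-≤ {zero}  f≤g = f≤g []
∑ₛ-mono-≤ {suc n} f≤g = ℕP.+-mono-≤ (∑ₛ-mono-≤ (f≤g ∘ (outside ∷_))) (∑ₛ-mono-≤ (f≤g ∘ (inside ∷_)))

∑ₛ-distrib-+ : ∀ {n} (f g : Subset n → ℕ) → ∑ₛ (λ p → f p + g p) ≡ ∑ₛ f + ∑ₛ g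
∑ₛ-distrib-+ {zero}  f g = refl
∑ₛ-distrib-+ {suc n} f g = trans
  (cong₂ _+_ (∑ₛ-distrib-+ (f ∘ (outside ∷_)) (g ∘ (outside ∷_))) (∑ₛ-distrib-+ (f ∘ (inside ∷_)) (g ∘ (inside ∷_))))
  (interchange (∑ₛ (f ∘ (outside ∷_))) (∑ₛ (g ∘ (outside ∷_))) (∑ₛ (f ∘ (inside ∷_))) (∑ₛ (g ∘ (inside ∷_))))

*-distribˡ-∑ₛ : ∀ {n} c (f : Subset n → ℕ) → c * ∑ₛ f ≡ ∑ₛ (λ p → c * f p)
*-distribˡ-∑ₛ {zero}  c f = refl
*-distribˡ-∑ₛ {suc n} c f = trans (ℕP.*-distribˡ-+ c (∑ₛ (f ∘ (outside ∷_))) (∑ₛ (f ∘ (inside ∷_))))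
  (cong₂ _+_ (*-distribˡ-∑ₛ c (f ∘ (outside ∷_))) (*-distribˡ-∑ₛ c (f ∘ (inside ∷_))))

*-distribʳ-∑ₛ : ∀ {n} c (f : Subset n → ℕ) → ∑ₛ f * c ≡ ∑ₛ (λ p → f p * c)
*-distribʳ-∑ₛ c f = trans (ℕP.*-comm (∑ₛ f) c) (trans (*-distribˡ-∑ₛ c f) (∑ₛ-cong λ p → ℕP.*-comm c (f p)))

f≤∑ₛ : ∀ {n} (f : Subset n → ℕ) p → f p ≤ ∑ₛ f
f≤∑ₛ f []            = ℕP.≤-refl
f≤∑ₛ f (outside ∷ p) = ℕP.≤-trans (f≤∑ₛ (f ∘ (outside ∷_)) p) (ℕP.m≤m+n _ _)
f≤∑ₛ f (inside ∷ p)  = ℕP.≤-trans (f≤∑ₛ (f ∘ (inside ∷_)) p) (ℕP.m≤n+m _ _)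

∑ₛ-comm-sum : ∀ {n m} (f : Subset n → Fin m → ℕ) → ∑ₛ (λ p → sum (f p)) ≡ sum (λ i → ∑ₛ (λ p → f p i))
∑ₛ-comm-sum {zero}  f = refl
∑ₛ-comm-sum {suc n} f = trans (cong₂ _+_ (∑ₛ-comm-sum (f ∘ (outside ∷_))) (∑ₛ-comm-sum (f ∘ (inside ∷_))))
  (sym (∑-distrib-+ (λ i → ∑ₛ (λ p → f (outside ∷ p) i)) (λ i → ∑ₛ (λ p → f (inside ∷ p) i))))

∑ₛ-0 : ∀ {n} (f : Subset n → ℕ) → (∀ p → f p ≡ 0) → ∑ₛ f ≡ 0
∑ₛ-0 {zero}  f f≡0 = f≡0 []
∑ₛ-0 {suc n} f f≡0 = cong₂ _+_ (∑ₛ-0 (f ∘ (outside ∷_)) (f≡0 ∘ (outside ∷_))) (∑ₛ-0 (f ∘ (inside ∷_)) (f≡0 ∘ (inside ∷_)))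

∑ₛ-supported : ∀ {n} (f : Subset n → ℕ) {p₀} → (∀ p → 0 < f p → p ≡ p₀) → ∑ₛ f ≡ f p₀
∑ₛ-supported {zero}  f {[]} _ = refl
∑ₛ-supported {suc n} f {outside ∷ p₀} supp = trans (cong₂ _+_
  (∑ₛ-supported (f ∘ (outside ∷_)) λ p fp>0 → ∷-injectiveʳ (supp _ fp>0))
  (∑ₛ-0 (f ∘ (inside ∷_)) λ p → ℕP.n≤0⇒n≡0 (ℕP.≮⇒≥ λ fp>0 → case supp _ fp>0 of λ ())))
  (ℕP.+-identityʳ _)
∑ₛ-supported {suc n} f {inside ∷ p₀} supp = cong₂ _+_
  (∑ₛ-0 (f ∘ (outside ∷_)) λ p → ℕP.n≤0⇒n≡0 (ℕP.≮⇒≥ λ fp>0 → case supp _ fp>0 of λ ()))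
  (∑ₛ-supported (f ∘ (inside ∷_)) λ p fp>0 → ∷-injectiveʳ (supp _ fp>0))

∣p∣≡1+others : ∀ {n} {p : Subset n} {i} → i ∈ p → ∣ p ∣ ≡ suc (sum (λ k → 𝟙 (¬? (i ≟ k)) * 𝟙 (k ∈? p)))
∣p∣≡1+others {p = p} {i} i∈p = begin
  ∣ p ∣
    ≡⟨ ∣p∣≡sum𝟙∈ p ⟩
  sum (λ k → 𝟙 (k ∈? p))
    ≡⟨ sum-split i (λ k → 𝟙 (k ∈? p)) ⟩
  𝟙 (i ∈? p) + sum (λ k → 𝟙 (¬? (i ≟ k)) * 𝟙 (k ∈? p))
    ≡⟨ cong (_+ sum (λ k → 𝟙 (¬? (i ≟ k)) * 𝟙 (k ∈? p))) (𝟙-yes (i ∈? p) i∈p) ⟩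
  suc (sum (λ k → 𝟙 (¬? (i ≟ k)) * 𝟙 (k ∈? p))) ∎
  where open ≡-Reasoning

∣p∣≡2+others : ∀ {n} {p : Subset n} {i j} → i ≢ j → i ∈ p → j ∈ p →
  ∣ p ∣ ≡ 2 + sum (λ k → 𝟙 (¬? (i ≟ k)) * 𝟙 (¬? (j ≟ k)) * 𝟙 (k ∈? p))
∣p∣≡2+others {p = p} {i} {j} i≢j i∈p j∈p = begin
  ∣ p ∣                   ≡⟨ ∣p∣≡sum𝟙∈ p ⟩
  sum (λ k → 𝟙 (k ∈? p))  ≡⟨ sum-split₂ i≢j (λ k → 𝟙 (k ∈? p)) ⟩
  𝟙 (i ∈? p) + 𝟙 (j ∈? p) + others ≡⟨ cong₂ (λ a b → a + b + others) (𝟙-yes (i ∈? p) i∈p) (𝟙-yes (j ∈? p) j∈p) ⟩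
  2 + others              ∎
  where
  open ≡-Reasoning
  others = sum (λ k → 𝟙 (¬? (i ≟ k)) * 𝟙 (¬? (j ≟ k)) * 𝟙 (k ∈? p))

-- Hypergraphs and greedy transversals

-- j! · H_j, where H_j is the j-th harmonic number.
harmonicNumerator : ℕ → ℕ
harmonicNumerator zero    = 0
harmonicNumerator (suc j) = suc j * harmonicNumerator j + j !

∣p∪q∣≤∣p∣+∣q∣ : ∀ {n} (p q : Subset n) → ∣ p ∪ q ∣ ≤ ∣ p ∣ + ∣ q ∣
∣p∪q∣≤∣p∣+∣q∣ []            []            = z≤n
∣p∪q∣≤∣p∣+∣q∣ (outside ∷ p) (outside ∷ q) = ∣p∪q∣≤∣p∣+∣q∣ p q
∣p∪q∣≤∣p∣+∣q∣ (outside ∷ p) (inside ∷ q)  =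
  ℕP.≤-trans (s≤s (∣p∪q∣≤∣p∣+∣q∣ p q)) (ℕP.≤-reflexive (sym (ℕP.+-suc ∣ p ∣ ∣ q ∣)))
∣p∪q∣≤∣p∣+∣q∣ (inside ∷ p)  (outside ∷ q) = s≤s (∣p∪q∣≤∣p∣+∣q∣ p q)
∣p∪q∣≤∣p∣+∣q∣ (inside ∷ p)  (inside ∷ q)  =
  s≤s (ℕP.≤-trans (∣p∪q∣≤∣p∣+∣q∣ p q) (ℕP.+-monoʳ-≤ ∣ p ∣ (ℕP.n≤1+n ∣ q ∣)))

-- A multi-hypergraph on Fin n: the multiplicity of every subset as an edge.
Hypergraph : ℕ → Set
Hypergraph n = Subset n → ℕ

module _ {n : ℕ} where

  infixl 7 _through_ _avoiding_

  _through_ : Hypergraph n → Fin n → Hypergraph n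
  (u through x) e = u e * 𝟙 (x ∈? e)

  _avoiding_ : Hypergraph n → Fin n → Hypergraph n
  (u avoiding x) e = u e * 𝟙 (¬? (x ∈? e))

  degree : Hypergraph n → Fin n → ℕ
  degree u x = ∑ₛ (u through x)

  Uniform : ℕ → Hypergraph n → Set
  Uniform k u = ∀ e → 0 < u e → ∣ e ∣ ≡ k

  Blocks : Subset n → Hypergraph n → Set
  Blocks S u = ∀ e → 0 < u e → Nonempty (S ∩ e)

  double-counting : ∀ (u : Hypergraph n) (g : Fin n → ℕ) →
    ∑ₛ (λ e → u e * sum (λ x → g x * 𝟙 (x ∈? e))) ≡ sum (λ x → g x * degree u x)
  double-counting u g = begin
    ∑ₛ (λ e → u e * sum (λ x → g x * 𝟙 (x ∈? e)))    ≡⟨ ∑ₛ-cong (λ e → *-distribˡ-sum (u e) (λ x → g x * 𝟙 (x ∈? e))) ⟩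
    ∑ₛ (λ e → sum (λ x → u e * (g x * 𝟙 (x ∈? e))))  ≡⟨ ∑ₛ-cong (λ e → sum-cong-≗ λ x → identity (u e) (g x) (𝟙 (x ∈? e))) ⟩
    ∑ₛ (λ e → sum (λ x → g x * (u e * 𝟙 (x ∈? e))))  ≡⟨ ∑ₛ-comm-sum (λ e x → g x * (u e * 𝟙 (x ∈? e))) ⟩
    sum (λ x → ∑ₛ (λ e → g x * (u e * 𝟙 (x ∈? e))))  ≡⟨ sum-cong-≗ (λ x → *-distribˡ-∑ₛ (g x) (u through x)) ⟨
    sum (λ x → g x * degree u x)                       ∎
    where
    open ≡-Reasoning
    identity : ∀ a b c → a * (b * c) ≡ b * (a * c)
    identity = solve-∀

  handshake : ∀ {k} (u : Hypergraph n) → Uniform k u → k * ∑ₛ u ≡ sum (degree u)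
  handshake {k} u uniform = begin
    k * ∑ₛ u                                          ≡⟨ *-distribˡ-∑ₛ k u ⟩
    ∑ₛ (λ e → k * u e)                                ≡⟨ ∑ₛ-cong edge ⟩
    ∑ₛ (λ e → u e * sum (λ x → 1 * 𝟙 (x ∈? e)))       ≡⟨ double-counting u (λ _ → 1) ⟩
    sum (λ x → 1 * degree u x)                        ≡⟨ sum-cong-≗ (λ x → ℕP.*-identityˡ (degree u x)) ⟩
    sum (degree u)                                    ∎
    where
    open ≡-Reasoning
    edge : ∀ e → k * u e ≡ u e * sum (λ x → 1 * 𝟙 (x ∈? e))
    edge e = trans (ℕP.*-comm k (u e)) (*-congˡ-pos (u e) λ ue>0 → begin
      k                           ≡⟨ uniform e ue>0 ⟨
      ∣ e ∣                        ≡⟨ ∣p∣≡sum𝟙∈ e ⟩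
      sum (λ x → 𝟙 (x ∈? e))       ≡⟨ sum-cong-≗ (λ x → ℕP.*-identityˡ (𝟙 (x ∈? e))) ⟨
      sum (λ x → 1 * 𝟙 (x ∈? e))   ∎)

  handshake-≤ : ∀ {k d} (u : Hypergraph n) → Uniform k u → (∀ x → degree u x ≤ d) → k * ∑ₛ u ≤ n * d
  handshake-≤ {k} {d} u uniform Δ≤d = begin
    k * ∑ₛ u            ≡⟨ handshake u uniform ⟩
    sum (degree u)      ≤⟨ sum-mono-≤ Δ≤d ⟩
    sum {n} (λ _ → d)   ≡⟨ sum-const n d ⟩
    n * d               ∎
    where open ℕP.≤-Reasoning

  through-∈ : ∀ (u : Hypergraph n) {x e} → x ∈ e → (u through x) e ≡ u e
  through-∈ u {x} {e} x∈e = trans (cong (u e *_) (𝟙-yes (x ∈? e) x∈e)) (ℕP.*-identityʳ (u e))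

  through-≤ : ∀ (u : Hypergraph n) x e → (u through x) e ≤ u e
  through-≤ u x e = m*𝟙≤m (u e) (x ∈? e)

  through-pos⁻¹ : ∀ (u : Hypergraph n) {x e} → 0 < (u through x) e → 0 < u e × x ∈ e
  through-pos⁻¹ u {x} {e} 0<ue·𝟙 = let 0<ue , 0<𝟙 = *-pos⁻¹ (u e) 0<ue·𝟙 in 0<ue , 𝟙-witness (x ∈? e) 0<𝟙

  avoiding-∉ : ∀ (u : Hypergraph n) {x e} → x ∉ e → (u avoiding x) e ≡ u e
  avoiding-∉ u {x} {e} x∉e = trans (cong (u e *_) (𝟙-yes (¬? (x ∈? e)) x∉e)) (ℕP.*-identityʳ (u e))

  avoiding+degree : ∀ (u : Hypergraph n) x → ∑ₛ (u avoiding x) + degree u x ≡ ∑ₛ u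
  avoiding+degree u x = trans (sym (∑ₛ-distrib-+ (u avoiding x) (u through x))) (∑ₛ-cong λ e → begin
    u e * 𝟙 (¬? (x ∈? e)) + u e * 𝟙 (x ∈? e)  ≡⟨ ℕP.*-distribˡ-+ (u e) _ _ ⟨
    u e * (𝟙 (¬? (x ∈? e)) + 𝟙 (x ∈? e))      ≡⟨ cong (u e *_) (𝟙¬+𝟙≡1 (x ∈? e)) ⟩
    u e * 1                                  ≡⟨ ℕP.*-identityʳ (u e) ⟩
    u e                                      ∎)
    where open ≡-Reasoning

  avoiding-≤ : ∀ (u : Hypergraph n) x e → (u avoiding x) e ≤ u e
  avoiding-≤ u x e = m*𝟙≤m (u e) (¬? (x ∈? e))

  degree-≤-∑ₛ : ∀ (u : Hypergraph n) x → degree u x ≤ ∑ₛ u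
  degree-≤-∑ₛ u x = ∑ₛ-mono-≤ (through-≤ u x)

  degree-mono-≤ : ∀ {u v : Hypergraph n} → (∀ e → v e ≤ u e) → ∀ x → degree v x ≤ degree u x
  degree-mono-≤ v≤u x = ∑ₛ-mono-≤ λ e → ℕP.*-monoˡ-≤ (𝟙 (x ∈? e)) (v≤u e)

  degree-0⇒Blocks : ∀ {k} {u : Hypergraph n} → 1 ≤ k → Uniform k u → (∀ x → degree u x ≤ 0) → ∀ S → Blocks S u
  degree-0⇒Blocks {k} {u} k≥1 uniform Δ≤0 S e ue>0 = ⊥-elim (ℕP.n≮0 (ℕP.≤-trans degree>0 (Δ≤0 x)))
    where
    e-nonempty : ∃ λ x → 0 < 𝟙 (x ∈? e)
    e-nonempty = sum-pos⇒∃ (λ x → 𝟙 (x ∈? e)) (subst (0 <_) (trans (sym (uniform e ue>0)) (∣p∣≡sum𝟙∈ e)) k≥1)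
    x : Fin n
    x = proj₁ e-nonempty
    degree>0 : 0 < degree u x
    degree>0 = ℕP.≤-trans (subst (0 <_) (sym (through-∈ u (𝟙-witness (x ∈? e) (proj₂ e-nonempty)))) ue>0)
                          (f≤∑ₛ (u through x) e)

  -- Greedily picking points of maximal degree j + 1 until there are none left; each pick
  -- removes j + 1 edges.
  record Peeling (j : ℕ) (u : Hypergraph n) : Set where
    field
      peeled      : Subset n
      rest        : Hypergraph n
      rest-≤      : ∀ e → rest e ≤ u e
      rest-degree : ∀ x → degree rest x ≤ j
      blocks      : ∀ S → Blocks S rest → Blocks (peeled ∪ S) u
      size        : suc j * ∣ peeled ∣ + ∑ₛ rest ≤ ∑ₛ u

  rest-uniform : ∀ {j k} {u : Hypergraph n} (p : Peeling j u) → Uniform k u → Uniform k (Peeling.rest p)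
  rest-uniform p uniform e 0<re = uniform e (ℕP.≤-trans 0<re (Peeling.rest-≤ p e))

  stop : ∀ {j} (u : Hypergraph n) → (∀ x → degree u x ≤ j) → Peeling j u
  stop {j} u Δ≤j = record
    { peeled      = ⊥
    ; rest        = u
    ; rest-≤      = λ _ → ℕP.≤-refl
    ; rest-degree = Δ≤j
    ; blocks      = λ S blocksS e ue>0 → subst (λ T → Nonempty (T ∩ e)) (sym (∪-identityˡ S)) (blocksS e ue>0)
    ; size        = ℕP.≤-reflexive (cong (_+ ∑ₛ u) (trans (cong (suc j *_) (∣⊥∣≡0 n)) (ℕP.*-zeroʳ (suc j))))
    }

  Nonempty-∩-mono : ∀ {p q e : Subset n} → p ⊆ q → Nonempty (p ∩ e) → Nonempty (q ∩ e)
  Nonempty-∩-mono {p} {q} {e} p⊆q (y , y∈p∩e) = y , x∈p∩q⁺ (p⊆q (proj₁ (x∈p∩q⁻ p e y∈p∩e)) , proj₂ (x∈p∩q⁻ p e y∈p∩e))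

  pick : ∀ {j} (u : Hypergraph n) x → degree u x ≡ suc j → Peeling j (u avoiding x) → Peeling j u
  pick {j} u x deg≡ p = record
    { peeled      = ⁅ x ⁆ ∪ peeled
    ; rest        = rest
    ; rest-≤      = λ e → ℕP.≤-trans (rest-≤ e) (avoiding-≤ u x e)
    ; rest-degree = rest-degree
    ; blocks      = blocks′
    ; size        = size′
    }
    where
    open Peeling p
    blocks′ : ∀ S → Blocks S rest → Blocks ((⁅ x ⁆ ∪ peeled) ∪ S) u
    blocks′ S blocksS e ue>0 with x ∈? e
    ... | yes x∈e = x , x∈p∩q⁺ (x∈p∪q⁺ (inj₁ (x∈p∪q⁺ (inj₁ (x∈⁅x⁆ x)))) , x∈e)
    ... | no x∉e  = Nonempty-∩-mono
      (λ y∈ → subst (_ ∈_) (sym (∪-assoc ⁅ x ⁆ peeled S)) (q⊆p∪q ⁅ x ⁆ (peeled ∪ S) y∈))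
      (blocks S blocksS e (subst (0 <_) (sym (avoiding-∉ u x∉e)) ue>0))
    size′ : suc j * ∣ ⁅ x ⁆ ∪ peeled ∣ + ∑ₛ rest ≤ ∑ₛ u
    size′ = begin
      suc j * ∣ ⁅ x ⁆ ∪ peeled ∣ + ∑ₛ rest
        ≤⟨ ℕP.+-monoˡ-≤ (∑ₛ rest) (ℕP.*-monoʳ-≤ (suc j) (∣p∪q∣≤∣p∣+∣q∣ ⁅ x ⁆ peeled)) ⟩
      suc j * (∣ ⁅ x ⁆ ∣ + ∣ peeled ∣) + ∑ₛ rest
        ≡⟨ cong (λ c → suc j * (c + ∣ peeled ∣) + ∑ₛ rest) (∣⁅x⁆∣≡1 x) ⟩
      suc j * (1 + ∣ peeled ∣) + ∑ₛ rest
        ≡⟨ identity (suc j) ∣ peeled ∣ (∑ₛ rest) ⟩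
      suc j * ∣ peeled ∣ + ∑ₛ rest + suc j
        ≤⟨ ℕP.+-monoˡ-≤ (suc j) size ⟩
      ∑ₛ (u avoiding x) + suc j
        ≡⟨ cong (∑ₛ (u avoiding x) +_) deg≡ ⟨
      ∑ₛ (u avoiding x) + degree u x
        ≡⟨ avoiding+degree u x ⟩
      ∑ₛ u ∎
      where
      open ℕP.≤-Reasoning
      identity : ∀ a b c → a * (1 + b) + c ≡ a * b + c + a
      identity = solve-∀

  peel : ∀ j (u : Hypergraph n) → (∀ x → degree u x ≤ suc j) → Peeling j u
  peel j u = go (∑ₛ u) u ℕP.≤-refl
    where
    go : ∀ m (u : Hypergraph n) → ∑ₛ u ≤ m → (∀ x → degree u x ≤ suc j) → Peeling j u
    go zero    u ∑u≤0 _ = stop u λ x → ℕP.≤-trans (degree-≤-∑ₛ u x) (ℕP.≤-trans ∑u≤0 z≤n)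
    go (suc m) u ∑u≤m Δ≤ with any? (λ x → suc j ≤? degree u x)
    ... | no ¬big       = stop u λ x → ℕP.≮⇒≥ (¬big ∘ (x ,_))
    ... | yes (x , big) = pick u x deg≡ (go m (u avoiding x) fewer λ y → ℕP.≤-trans (degree-mono-≤ (avoiding-≤ u x) y) (Δ≤ y))
      where
      deg≡ : degree u x ≡ suc j
      deg≡ = ℕP.≤-antisym (Δ≤ x) big
      fewer : ∑ₛ (u avoiding x) ≤ m
      fewer = ℕP.≤-pred (begin
        suc (∑ₛ (u avoiding x))         ≤⟨ ℕP.m<m+n (∑ₛ (u avoiding x)) (ℕP.≤-trans (s≤s z≤n) big) ⟩
        ∑ₛ (u avoiding x) + degree u x  ≡⟨ avoiding+degree u x ⟩
        ∑ₛ u                            ≤⟨ ∑u≤m ⟩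
        suc m                           ∎)
        where open ℕP.≤-Reasoning

  module _ {k : ℕ} (k≥1 : 1 ≤ k) where

    -- |S| ≤ |u| / (j + 1) + (n / k) (H_(j+1) - 1), cleared of denominators.
    greedy : ∀ j (u : Hypergraph n) → Uniform k u → (∀ x → degree u x ≤ suc j) →
      ∃ λ S → Blocks S u ×
        k * suc j ! * ∣ S ∣ + n * suc j ! ≤ k * j ! * ∑ₛ u + n * harmonicNumerator (suc j)
    greedy zero u uniform Δ≤1 =
      peeled ∪ ⊥ , blocks ⊥ (degree-0⇒Blocks k≥1 (rest-uniform p uniform) rest-degree ⊥) , bound
      where
      p : Peeling 0 u
      p = peel zero u Δ≤1
      open Peeling p
      bound : k * 1 * ∣ peeled ∪ ⊥ ∣ + n * 1 ≤ k * 1 * ∑ₛ u + n * 1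
      bound = ℕP.+-monoˡ-≤ (n * 1) (ℕP.*-monoʳ-≤ (k * 1) (begin
        ∣ peeled ∪ ⊥ ∣             ≡⟨ cong ∣_∣ (∪-identityʳ peeled) ⟩
        ∣ peeled ∣                 ≡⟨ ℕP.+-identityʳ ∣ peeled ∣ ⟨
        1 * ∣ peeled ∣             ≤⟨ ℕP.m≤m+n (1 * ∣ peeled ∣) (∑ₛ rest) ⟩
        1 * ∣ peeled ∣ + ∑ₛ rest   ≤⟨ size ⟩
        ∑ₛ u                       ∎))
        where open ℕP.≤-Reasoning
    greedy (suc j) u uniform Δ≤ =
      let S , blocksS , boundS = greedy j rest (rest-uniform p uniform) rest-degree
      in  peeled ∪ S , blocks S blocksS , bound S boundS
      where
      p : Peeling (suc j) u
      p = peel (suc j) u Δ≤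
      open Peeling p
      i : ℕ
      i = suc j
      bound : ∀ S → k * i ! * ∣ S ∣ + n * i ! ≤ k * j ! * ∑ₛ rest + n * harmonicNumerator i →
        k * suc i ! * ∣ peeled ∪ S ∣ + n * suc i ! ≤ k * i ! * ∑ₛ u + n * harmonicNumerator (suc i)
      bound S boundS = begin
        k * suc i ! * ∣ peeled ∪ S ∣ + n * suc i !
          ≤⟨ ℕP.+-monoˡ-≤ (n * suc i !) (ℕP.*-monoʳ-≤ (k * suc i !) (∣p∪q∣≤∣p∣+∣q∣ peeled S)) ⟩
        k * suc i ! * (∣ peeled ∣ + ∣ S ∣) + n * suc i !
          ≡⟨ regroup k j (j !) ∣ peeled ∣ ∣ S ∣ n ⟩
        k * i ! * (suc i * ∣ peeled ∣) + suc i * (k * i ! * ∣ S ∣ + n * i !)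
          ≤⟨ ℕP.+-monoʳ-≤ (k * i ! * (suc i * ∣ peeled ∣)) (ℕP.*-monoʳ-≤ (suc i) boundS) ⟩
        k * i ! * (suc i * ∣ peeled ∣) + suc i * (k * j ! * ∑ₛ rest + n * harmonicNumerator i)
          ≡⟨ regroup′ k j (j !) ∣ peeled ∣ (∑ₛ rest) n (harmonicNumerator i) ⟩
        k * i ! * (suc i * ∣ peeled ∣ + ∑ₛ rest) + j ! * (k * ∑ₛ rest) + n * (suc i * harmonicNumerator i)
          ≤⟨ ℕP.+-monoˡ-≤ (n * (suc i * harmonicNumerator i)) (ℕP.+-mono-≤
               (ℕP.*-monoʳ-≤ (k * i !) size)
               (ℕP.*-monoʳ-≤ (j !) (handshake-≤ rest (rest-uniform p uniform) rest-degree))) ⟩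
        k * i ! * ∑ₛ u + j ! * (n * i) + n * (suc i * harmonicNumerator i)
          ≡⟨ regroup″ k j (j !) (∑ₛ u) n (harmonicNumerator i) ⟩
        k * i ! * ∑ₛ u + n * harmonicNumerator (suc i) ∎
        where
        open ℕP.≤-Reasoning
        regroup : ∀ k j F P S n →
          k * ((2 + j) * ((1 + j) * F)) * (P + S) + n * ((2 + j) * ((1 + j) * F)) ≡
          k * ((1 + j) * F) * ((2 + j) * P) + (2 + j) * (k * ((1 + j) * F) * S + n * ((1 + j) * F))
        regroup = solve-∀
        regroup′ : ∀ k j F P r n H →
          k * ((1 + j) * F) * ((2 + j) * P) + (2 + j) * (k * F * r + n * H) ≡
          k * ((1 + j) * F) * ((2 + j) * P + r) + F * (k * r) + n * ((2 + j) * H)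
        regroup′ = solve-∀
        regroup″ : ∀ k j F U n H →
          k * ((1 + j) * F) * U + F * (n * (1 + j)) + n * ((2 + j) * H) ≡
          k * ((1 + j) * F) * U + n * ((2 + j) * H + (1 + j) * F)
        regroup″ = solve-∀

    transversal-≤ : ∀ j (u : Hypergraph n) → Uniform k u → (∀ x → degree u x ≤ suc j) →
      ∃ λ S → Blocks S u × k * suc j ! * ∣ S ∣ ≤ n * harmonicNumerator (suc j)
    transversal-≤ j u uniform Δ≤ =
      let S , blocksS , boundS = greedy j u uniform Δ≤
      in  S , blocksS , ℕP.+-cancelʳ-≤ (n * suc j !) _ _ (ℕP.≤-trans boundS edges)
      where
      edges : k * j ! * ∑ₛ u + n * harmonicNumerator (suc j) ≤ n * harmonicNumerator (suc j) + n * suc j !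
      edges = begin
        k * j ! * ∑ₛ u + n * harmonicNumerator (suc j)
          ≡⟨ regroup k (j !) (∑ₛ u) (n * harmonicNumerator (suc j)) ⟩
        j ! * (k * ∑ₛ u) + n * harmonicNumerator (suc j)
          ≤⟨ ℕP.+-monoˡ-≤ (n * harmonicNumerator (suc j)) (ℕP.*-monoʳ-≤ (j !) (handshake-≤ u uniform Δ≤)) ⟩
        j ! * (n * suc j) + n * harmonicNumerator (suc j)
          ≡⟨ regroup′ (j !) n j (n * harmonicNumerator (suc j)) ⟩
        n * harmonicNumerator (suc j) + n * suc j ! ∎
        where
        open ℕP.≤-Reasoning
        regroup : ∀ k F U A → k * F * U + A ≡ F * (k * U) + A
        regroup = solve-∀
        regroup′ : ∀ F n j A → F * (n * (1 + j)) + A ≡ A + n * ((1 + j) * F)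
        regroup′ = solve-∀

-- Möbius planes

infix 4 _≟ₛ_
_≟ₛ_ : ∀ {n} (p q : Subset n) → Dec (p ≡ q)
_≟ₛ_ = ≡-dec _≟ᵇ_

∃-third : ∀ {n} (p : Subset n) → 2 < ∣ p ∣ → ∀ x y → ∃ λ z → z ∈ p × x ≢ z × y ≢ z
∃-third {n} p 2<∣p∣ x y =
  let z , 0<hz = sum-pos⇒∃ h (ℕP.≤-pred (ℕP.≤-pred (ℕP.≤-trans 2<∣p∣ ∣p∣≤2+∑h)))
      0<𝟙y≢z , 0<gz = *-pos⁻¹ (𝟙 (¬? (y ≟ z))) 0<hz
      0<𝟙x≢z , 0<fz = *-pos⁻¹ (𝟙 (¬? (x ≟ z))) 0<gz
  in  z , 𝟙-witness (z ∈? p) 0<fz , 𝟙-witness (¬? (x ≟ z)) 0<𝟙x≢z , 𝟙-witness (¬? (y ≟ z)) 0<𝟙y≢z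
  where
  f g h : Fin n → ℕ
  f z = 𝟙 (z ∈? p)
  g z = 𝟙 (¬? (x ≟ z)) * f z
  h z = 𝟙 (¬? (y ≟ z)) * g z
  ∣p∣≤2+∑h : ∣ p ∣ ≤ 2 + sum h
  ∣p∣≤2+∑h = begin
    ∣ p ∣
      ≡⟨ ∣p∣≡sum𝟙∈ p ⟩
    sum f
      ≡⟨ sum-split x f ⟩
    f x + sum g
      ≡⟨ cong (f x +_) (sum-split y g) ⟩
    f x + (g y + sum h)
      ≤⟨ ℕP.+-mono-≤ (𝟙≤1 (x ∈? p)) (ℕP.+-monoˡ-≤ (sum h) (ℕP.≤-trans (m*𝟙≤m _ (y ∈? p)) (𝟙≤1 (¬? (x ≟ y))))) ⟩
    1 + (1 + sum h) ∎
    where open ℕP.≤-Reasoning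

∃-three-distinct : ∀ {n} (p : Subset n) → 2 < ∣ p ∣ →
  ∃ λ x → ∃ λ y → ∃ λ z → (x ≢ y × x ≢ z × y ≢ z) × x ∈ p × y ∈ p × z ∈ p
∃-three-distinct p 2<∣p∣ =
  let x , 0<𝟙x∈p = sum-pos⇒∃ (λ x → 𝟙 (x ∈? p)) (subst (0 <_) (∣p∣≡sum𝟙∈ p) (ℕP.≤-trans (s≤s z≤n) 2<∣p∣))
      y , y∈p , x≢y , _ = ∃-third p 2<∣p∣ x x
      z , z∈p , x≢z , y≢z = ∃-third p 2<∣p∣ x y
  in  x , y , z , (x≢y , x≢z , y≢z) , 𝟙-witness (x ∈? p) 0<𝟙x∈p , y∈p , z∈p

≡⁅x⁆⊎∃-other : ∀ {n} {p : Subset n} {x} → x ∈ p → p ≡ ⁅ x ⁆ ⊎ ∃ λ y → y ∈ p × x ≢ y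
≡⁅x⁆⊎∃-other {p = p} {x} x∈p with any? (λ y → y ∈? p ×-dec ¬? (x ≟ y))
... | yes other = inj₂ other
... | no ¬other = inj₁ (⊆-antisym p⊆⁅x⁆ λ y∈⁅x⁆ → subst (_∈ p) (sym (x∈⁅y⁆⇒x≡y x y∈⁅x⁆)) x∈p)
  where
  p⊆⁅x⁆ : p ⊆ ⁅ x ⁆
  p⊆⁅x⁆ {y} y∈p with x ≟ y
  ... | yes refl = x∈⁅x⁆ x
  ... | no x≢y   = contradiction (y , y∈p , x≢y) ¬other

∈∧∉⇒≢ : ∀ {n} {p : Subset n} {x y} → x ∈ p → y ∉ p → x ≢ y
∈∧∉⇒≢ x∈p y∉p refl = y∉p x∈p

module Plane (M : MobiusPlane) where

  Point : Set
  Point = Fin (n M)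

  Distinct : Point → Point → Point → Set
  Distinct P Q R = P ≢ Q × P ≢ R × Q ≢ R

  distinct? : ∀ P Q R → Dec (Distinct P Q R)
  distinct? P Q R = ¬? (P ≟ Q) ×-dec ¬? (P ≟ R) ×-dec ¬? (Q ≟ R)

  IsCircleThrough : Subset (n M) → Point → Point → Point → Set
  IsCircleThrough z P Q R = Circle M z × P ∈ z × Q ∈ z × R ∈ z

  module _ {P Q R : Point} (d : Distinct P Q R) where

    circleThrough : Subset (n M)
    circleThrough = proj₁ (ax1 M P Q R (proj₁ d) (proj₁ (proj₂ d)) (proj₂ (proj₂ d)))

    circleThrough-spec : IsCircleThrough circleThrough P Q R
    circleThrough-spec = proj₁ (proj₂ (ax1 M P Q R (proj₁ d) (proj₁ (proj₂ d)) (proj₂ (proj₂ d))))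

    circleThrough-unique : ∀ {z} → IsCircleThrough z P Q R → z ≡ circleThrough
    circleThrough-unique (cz , P∈z , Q∈z , R∈z) =
      proj₂ (proj₂ (ax1 M P Q R (proj₁ d) (proj₁ (proj₂ d)) (proj₂ (proj₂ d)))) _ cz P∈z Q∈z R∈z

  Spans : Subset (n M) → Point → Point → Point → Set
  Spans z P Q R = Σ (Distinct P Q R) λ d → z ≡ circleThrough d

  spans? : ∀ z P Q R → Dec (Spans z P Q R)
  spans? z P Q R with distinct? P Q R
  ... | no ¬d = no (¬d ∘ proj₁)
  ... | yes d = map′ (d ,_) (λ (d′ , z≡) → trans z≡ (circleThrough-unique d (circleThrough-spec d′))) (z ≟ₛ circleThrough d)

  IsSpanned : Subset (n M) → Set
  IsSpanned z = ∃ λ P → ∃ λ Q → ∃ λ R → Spans z P Q R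

  spanned⇒circle : ∀ {z} → IsSpanned z → Circle M z
  spanned⇒circle (_ , _ , _ , d , z≡) = subst (Circle M) (sym z≡) (proj₁ (circleThrough-spec d))

  circle⇒spanned : ∀ {z} → Circle M z → IsSpanned z
  circle⇒spanned {z} cz =
    let P , Q , R , d , P∈z , Q∈z , R∈z = ∃-three-distinct z (ax3b M z cz)
    in  P , Q , R , d , circleThrough-unique d (cz , P∈z , Q∈z , R∈z)

  -- A circle is the circle through any three of its points, so there are finitely many
  -- candidates to compare with.
  circle? : Decidable (Circle M)
  circle? z = map′ spanned⇒circle circle⇒spanned (any? λ P → any? λ Q → any? λ R → spans? z P Q R)

  circles : Hypergraph (n M)
  circles z = 𝟙 (circle? z)

  Blocks⇒IsBlockingSet : ∀ {S} → Blocks S circles → IsBlockingSet M S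
  Blocks⇒IsBlockingSet blocks z cz = blocks z (ℕP.≤-reflexive (sym (𝟙-yes (circle? z) cz)))

  ∃-distinct-points : ∃ λ P → ∃ λ Q → P ≢ Q
  ∃-distinct-points =
    let z , cz = ax3a M
        P , Q , _ , (P≢Q , _) , _ = ∃-three-distinct z (ax3b M z cz)
    in  P , Q , P≢Q

  -- Take R off P, Q and S off the circle d through P, Q, R: the circle through P, R, S
  -- would be d if it contained Q.
  ∃-circle-separating : ∀ {P Q} → P ≢ Q → ∃ λ c → Circle M c × P ∈ c × Q ∉ c
  ∃-circle-separating {P} {Q} P≢Q =
    let z₀ , cz₀ = ax3a M
        R , _ , P≢R , Q≢R = ∃-third z₀ (ax3b M z₀ cz₀) P Q
        dPQR = P≢Q , P≢R , Q≢R
        _ , P∈d , _ , R∈d = circleThrough-spec dPQR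
        S , S∉d = ax4 M (circleThrough dPQR) (proj₁ (circleThrough-spec dPQR))
        dPRS = P≢R , ∈∧∉⇒≢ P∈d S∉d , ∈∧∉⇒≢ R∈d S∉d
        cc , P∈c , R∈c , S∈c = circleThrough-spec dPRS
        Q∉c = λ Q∈c → S∉d (subst (S ∈_) (circleThrough-unique dPQR (cc , P∈c , Q∈c , R∈c)) S∈c)
    in  circleThrough dPRS , cc , P∈c , Q∉c

-- The order is written 2 + t: it is at least 2 by (iii), and q - 1 = 1 + t occurs below.
module Counting (M : MobiusPlane) (t : ℕ) (order : HasOrder M (2 + t)) where

  open Plane M

  q : ℕ
  q = 2 + t

  circles-through₂-pos⁻¹ : ∀ {P Q w} → 0 < (circles through P through Q) w → Circle M w × P ∈ w × Q ∈ w
  circles-through₂-pos⁻¹ {P} {Q} {w} pos =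
    let 0<cP , Q∈w = through-pos⁻¹ (circles through P) pos
        0<c , P∈w = through-pos⁻¹ circles 0<cP
    in  𝟙-witness (circle? w) 0<c , P∈w , Q∈w

  circleThrough-counted : ∀ {P Q R} (d : Distinct P Q R) → (circles through P through Q through R) (circleThrough d) ≡ 1
  circleThrough-counted {P} {Q} {R} d =
    let cc , P∈c , Q∈c , R∈c = circleThrough-spec d
    in  trans (through-∈ (circles through P through Q) R∈c) (trans (through-∈ (circles through P) Q∈c)
          (trans (through-∈ circles P∈c) (𝟙-yes (circle? (circleThrough d)) cc)))

  codegree₃-≤1 : ∀ {P Q R} → Distinct P Q R → degree (circles through P through Q) R ≤ 1
  codegree₃-≤1 {P} {Q} {R} d = ℕP.≤-reflexive (trans
    (∑ₛ-supported (circles through P through Q through R) λ w pos →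
      let 0<cPQ , R∈w = through-pos⁻¹ (circles through P through Q) pos
          cw , P∈w , Q∈w = circles-through₂-pos⁻¹ 0<cPQ
      in  circleThrough-unique d (cw , P∈w , Q∈w , R∈w))
    (circleThrough-counted d))

  tangents-≤1 : ∀ {P Q c} → Circle M c → P ∈ c → Q ∉ c →
    ∑ₛ (λ w → (circles through P through Q) w * 𝟙 (c ∩ w ≟ₛ ⁅ P ⁆)) ≤ 1
  tangents-≤1 {P} {Q} {c} cc P∈c Q∉c = begin
    ∑ₛ (λ w → u w * 𝟙 (c ∩ w ≟ₛ ⁅ P ⁆))   ≡⟨ ∑ₛ-supported (λ w → u w * 𝟙 (c ∩ w ≟ₛ ⁅ P ⁆)) tangent-unique ⟩
    u z′ * 𝟙 (c ∩ z′ ≟ₛ ⁅ P ⁆)             ≤⟨ m*𝟙≤m (u z′) (c ∩ z′ ≟ₛ ⁅ P ⁆) ⟩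
    u z′                                   ≤⟨ ℕP.≤-trans (through-≤ (circles through P) Q z′) (through-≤ circles P z′) ⟩
    circles z′                             ≤⟨ 𝟙≤1 (circle? z′) ⟩
    1                                      ∎
    where
    open ℕP.≤-Reasoning
    u : Hypergraph (n M)
    u = circles through P through Q
    z′ : Subset (n M)
    z′ = proj₁ (ax2 M c cc P Q P∈c Q∉c)
    tangent-unique : ∀ w → 0 < u w * 𝟙 (c ∩ w ≟ₛ ⁅ P ⁆) → w ≡ z′
    tangent-unique w pos =
      let 0<uw , 0<𝟙 = *-pos⁻¹ (u w) pos
          cw , P∈w , Q∈w = circles-through₂-pos⁻¹ 0<uw
      in  proj₂ (proj₂ (ax2 M c cc P Q P∈c Q∉c)) w cw P∈w Q∈w (𝟙-witness (c ∩ w ≟ₛ ⁅ P ⁆) 0<𝟙)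

  -- A circle through P and Q either meets a fixed circle c ∋ P, Q ∉ c in a second point, or touches c at P.
  codegree-≤ : ∀ {P Q} → P ≢ Q → degree (circles through P) Q ≤ suc q
  codegree-≤ {P} {Q} P≢Q = let c , cc , P∈c , Q∉c = ∃-circle-separating P≢Q in bound cc P∈c Q∉c
    where
    u : Hypergraph (n M)
    u = circles through P through Q
    bound : ∀ {c} → Circle M c → P ∈ c → Q ∉ c → ∑ₛ u ≤ suc q
    bound {c} cc P∈c Q∉c = begin
      ∑ₛ u
        ≤⟨ ∑ₛ-mono-≤ covered ⟩
      ∑ₛ (λ w → u w * sum (λ R → g R * 𝟙 (R ∈? w)) + u w * T w)
        ≡⟨ ∑ₛ-distrib-+ (λ w → u w * sum (λ R → g R * 𝟙 (R ∈? w))) (λ w → u w * T w) ⟩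
      ∑ₛ (λ w → u w * sum (λ R → g R * 𝟙 (R ∈? w))) + ∑ₛ (λ w → u w * T w)
        ≡⟨ cong (_+ ∑ₛ (λ w → u w * T w)) (double-counting u g) ⟩
      sum (λ R → g R * degree u R) + ∑ₛ (λ w → u w * T w)
        ≤⟨ ℕP.+-mono-≤ (sum-mono-≤ λ R → *-monoʳ-≤-pos (g R) (codegree₃-≤1 ∘ distinct R)) (tangents-≤1 cc P∈c Q∉c) ⟩
      sum (λ R → g R * 1) + 1
        ≡⟨ cong (_+ 1) (sum-cong-≗ λ R → ℕP.*-identityʳ (g R)) ⟩
      sum g + 1
        ≡⟨ cong (_+ 1) (ℕP.suc-injective (trans (sym (∣p∣≡1+others P∈c)) (order c cc))) ⟩
      q + 1
        ≡⟨ ℕP.+-comm q 1 ⟩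
      suc q ∎
      where
      open ℕP.≤-Reasoning
      g : Point → ℕ
      g R = 𝟙 (¬? (P ≟ R)) * 𝟙 (R ∈? c)
      T : Subset (n M) → ℕ
      T w = 𝟙 (c ∩ w ≟ₛ ⁅ P ⁆)
      distinct : ∀ R → 0 < g R → Distinct P Q R
      distinct R pos = let P≢R , R∈c = *-pos⁻¹ (𝟙 (¬? (P ≟ R))) pos
                       in  P≢Q , 𝟙-witness (¬? (P ≟ R)) P≢R , ≢-sym (∈∧∉⇒≢ (𝟙-witness (R ∈? c) R∈c) Q∉c)
      meets : ∀ {w} → Circle M w → P ∈ w → 1 ≤ sum (λ R → g R * 𝟙 (R ∈? w)) + T w
      meets {w} cw P∈w with ≡⁅x⁆⊎∃-other (x∈p∩q⁺ (P∈c , P∈w))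
      ... | inj₁ c∩w≡⁅P⁆          = ℕP.≤-trans (ℕP.≤-reflexive (sym (𝟙-yes (c ∩ w ≟ₛ ⁅ P ⁆) c∩w≡⁅P⁆))) (ℕP.m≤n+m (T w) _)
      ... | inj₂ (R , R∈c∩w , P≢R) = ℕP.≤-trans (ℕP.≤-trans (ℕP.≤-reflexive (sym gR·𝟙≡1)) (f≤sum (λ R → g R * 𝟙 (R ∈? w)) R)) (ℕP.m≤m+n _ (T w))
        where
        gR·𝟙≡1 : g R * 𝟙 (R ∈? w) ≡ 1
        gR·𝟙≡1 = let R∈c , R∈w = x∈p∩q⁻ c w R∈c∩w
                 in  cong₂ _*_ (cong₂ _*_ (𝟙-yes (¬? (P ≟ R)) P≢R) (𝟙-yes (R ∈? c) R∈c)) (𝟙-yes (R ∈? w) R∈w)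
      covered : ∀ w → u w ≤ u w * sum (λ R → g R * 𝟙 (R ∈? w)) + u w * T w
      covered w = begin
        u w
          ≡⟨ ℕP.*-identityʳ (u w) ⟨
        u w * 1
          ≤⟨ *-monoʳ-≤-pos (u w) (λ pos → let cw , P∈w , _ = circles-through₂-pos⁻¹ {P} {Q} pos in meets cw P∈w) ⟩
        u w * (sum (λ R → g R * 𝟙 (R ∈? w)) + T w)
          ≡⟨ ℕP.*-distribˡ-+ (u w) _ (T w) ⟩
        u w * sum (λ R → g R * 𝟙 (R ∈? w)) + u w * T w ∎

  -- Every point other than P and Q lies on one of the at most q + 1 circles through P and Q,
  -- each of which has q - 1 further points.
  points-≤ : n M ≤ suc (q * q)
  points-≤ = let _ , _ , P≢Q = ∃-distinct-points in bound P≢Q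
    where
    bound : ∀ {P Q} → P ≢ Q → n M ≤ suc (q * q)
    bound {P} {Q} P≢Q = begin
      n M
        ≡⟨ trans (sym (ℕP.*-identityʳ (n M))) (sym (sum-const (n M) 1)) ⟩
      sum {n M} (λ _ → 1)
        ≡⟨ sum-split₂ P≢Q (λ _ → 1) ⟩
      2 + sum (λ R → g R * 1)
        ≤⟨ ℕP.+-monoʳ-≤ 2 (sum-mono-≤ λ R → *-monoʳ-≤-pos (g R) (on-some-circle R)) ⟩
      2 + sum (λ R → g R * degree u R)
        ≡⟨ cong (2 +_) (double-counting u g) ⟨
      2 + ∑ₛ (λ w → u w * sum (λ R → g R * 𝟙 (R ∈? w)))
        ≡⟨ cong (2 +_) (∑ₛ-cong λ w → *-congˡ-pos (u w) (others w)) ⟩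
      2 + ∑ₛ (λ w → u w * suc t)
        ≡⟨ cong (2 +_) (*-distribʳ-∑ₛ (suc t) u) ⟨
      2 + ∑ₛ u * suc t
        ≤⟨ ℕP.+-monoʳ-≤ 2 (ℕP.*-monoˡ-≤ (suc t) (codegree-≤ P≢Q)) ⟩
      2 + suc q * suc t
        ≡⟨ identity t ⟩
      suc (q * q) ∎
      where
      open ℕP.≤-Reasoning
      u : Hypergraph (n M)
      u = circles through P through Q
      g : Point → ℕ
      g R = 𝟙 (¬? (P ≟ R)) * 𝟙 (¬? (Q ≟ R))
      on-some-circle : ∀ R → 0 < g R → 1 ≤ degree u R
      on-some-circle R pos =
        let P≢R , Q≢R = *-pos⁻¹ (𝟙 (¬? (P ≟ R))) pos
            d = P≢Q , 𝟙-witness (¬? (P ≟ R)) P≢R , 𝟙-witness (¬? (Q ≟ R)) Q≢R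
        in  ℕP.≤-trans (ℕP.≤-reflexive (sym (circleThrough-counted d))) (f≤∑ₛ (u through R) (circleThrough d))
      others : ∀ w → 0 < u w → sum (λ R → g R * 𝟙 (R ∈? w)) ≡ suc t
      others w pos = let cw , P∈w , Q∈w = circles-through₂-pos⁻¹ pos
                     in  ℕP.suc-injective (ℕP.suc-injective (trans (sym (∣p∣≡2+others P≢Q P∈w Q∈w)) (order w cw)))
      identity : ∀ t → 2 + (3 + t) * (1 + t) ≡ suc ((2 + t) * (2 + t))
      identity = solve-∀

  degree-≤ : ∀ P → degree circles P ≤ q * (q + 1)
  degree-≤ P = ℕP.*-cancelʳ-≤ (degree circles P) (q * (q + 1)) q (begin
    degree circles P * q
      ≡⟨ *-distribʳ-∑ₛ q (circles through P) ⟩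
    ∑ₛ (λ w → (circles through P) w * q)
      ≡⟨ ∑ₛ-cong (λ w → *-congˡ-pos ((circles through P) w) (others w)) ⟩
    ∑ₛ (λ w → (circles through P) w * sum (λ Q → g Q * 𝟙 (Q ∈? w)))
      ≡⟨ double-counting (circles through P) g ⟩
    sum (λ Q → g Q * degree (circles through P) Q)
      ≤⟨ sum-mono-≤ (λ Q → *-monoʳ-≤-pos (g Q) (codegree-≤ ∘ 𝟙-witness (¬? (P ≟ Q)))) ⟩
    sum (λ Q → g Q * suc q)
      ≡⟨ sum-cong-≗ (λ Q → cong (_* suc q) (sym (ℕP.*-identityʳ (g Q)))) ⟩
    sum (λ Q → g Q * 1 * suc q)
      ≡⟨ *-distribʳ-sum (suc q) (λ Q → g Q * 1) ⟨
    sum (λ Q → g Q * 1) * suc q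
      ≤⟨ ℕP.*-monoˡ-≤ (suc q) others≤ ⟩
    q * q * suc q
      ≡⟨ identity q ⟩
    q * (q + 1) * q ∎)
    where
    open ℕP.≤-Reasoning
    g : Point → ℕ
    g Q = 𝟙 (¬? (P ≟ Q))
    others : ∀ w → 0 < (circles through P) w → q ≡ sum (λ Q → g Q * 𝟙 (Q ∈? w))
    others w pos = let 0<c , P∈w = through-pos⁻¹ circles {P} pos
                   in  ℕP.suc-injective (trans (sym (order w (𝟙-witness (circle? w) 0<c))) (∣p∣≡1+others P∈w))
    others≤ : sum (λ Q → g Q * 1) ≤ q * q
    others≤ = ℕP.≤-pred (begin
      suc (sum (λ Q → g Q * 1))  ≡⟨ sum-split P (λ _ → 1) ⟨
      sum {n M} (λ _ → 1)        ≡⟨ trans (sum-const (n M) 1) (ℕP.*-identityʳ (n M)) ⟩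
      n M                        ≤⟨ points-≤ ⟩
      suc (q * q)                ∎)
    identity : ∀ q → q * q * suc q ≡ q * (q + 1) * q
    identity = solve-∀

  circles-uniform : Uniform (suc q) circles
  circles-uniform e 0<ce = order e (𝟙-witness (circle? e) 0<ce)

  -- |B| ≤ (q² + 1) / (q + 1) · H_(q(q+1)), cleared of denominators.
  minimum-blocking-set-≤ : ∀ {B} → IsMinimumBlockingSet M B →
    ∣ B ∣ * (q + 1) * (q * (q + 1)) ! ≤ harmonicNumerator (q * (q + 1)) * suc (q * q)
  minimum-blocking-set-≤ {B} (_ , minimal) =
    let S , blocks , bound = transversal-≤ (s≤s z≤n) (pred r) circles circles-uniform degree-≤
    in  begin
      ∣ B ∣ * (q + 1) * r !
        ≤⟨ ℕP.*-monoˡ-≤ (r !) (ℕP.*-monoˡ-≤ (q + 1) (minimal S (Blocks⇒IsBlockingSet blocks))) ⟩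
      ∣ S ∣ * (q + 1) * r !
        ≡⟨ regroup ∣ S ∣ q (r !) ⟩
      suc q * r ! * ∣ S ∣
        ≤⟨ bound ⟩
      n M * harmonicNumerator r
        ≤⟨ ℕP.*-monoˡ-≤ (harmonicNumerator r) points-≤ ⟩
      suc (q * q) * harmonicNumerator r
        ≡⟨ ℕP.*-comm (suc (q * q)) (harmonicNumerator r) ⟩
      harmonicNumerator r * suc (q * q) ∎
    where
    open ℕP.≤-Reasoning
    r : ℕ
    r = q * (q + 1)
    regroup : ∀ s q f → s * (q + 1) * f ≡ suc q * f * s
    regroup = solve-∀

open import Data.Integer using (+_)
open import Data.Rational as ℚ using (_/_)
import Data.Rational.Properties as ℚP

open Exponential

harmonic≡harmonicNumerator/! : ∀ j → harmonic j ≡ (+ harmonicNumerator j / j !) {{j ℕP.!≢0}}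
harmonic≡harmonicNumerator/! zero    = refl
harmonic≡harmonicNumerator/! (suc j) = begin
  harmonic j ℚ.+ + 1 / suc j
    ≡⟨ cong (ℚ._+ + 1 / suc j) (harmonic≡harmonicNumerator/! j) ⟩
  (+ H / j !) {{j ℕP.!≢0}} ℚ.+ + 1 / suc j
    ≡⟨ a/b+c/d H (j !) 1 (suc j) {{j ℕP.!≢0}} ⟩
  (+ (H * suc j + 1 * j !) / (j ! * suc j)) {{j!*sj≢0}}
    ≡⟨ a/b≡c/d (H * suc j + 1 * j !) (j ! * suc j) (harmonicNumerator (suc j)) (suc j !) {{j!*sj≢0}} {{suc j ℕP.!≢0}} (identity H (j !) j) ⟩
  (+ harmonicNumerator (suc j) / suc j !) {{suc j ℕP.!≢0}} ∎
  where
  open ≡-Reasoning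
  H : ℕ
  H = harmonicNumerator j
  j!*sj≢0 : NonZero (j ! * suc j)
  j!*sj≢0 = ℕP.m*n≢0 (j !) (suc j) {{j ℕP.!≢0}}
  identity : ∀ H F j → (H * (1 + j) + 1 * F) * ((1 + j) * F) ≡ ((1 + j) * H + F) * (F * (1 + j))
  identity = solve-∀

order≥2 : ∀ M {q} → HasOrder M q → 2 ≤ q
order≥2 M order = let z , cz = ax3a M in ℕP.≤-pred (subst (3 ≤_) (order z cz) (ax3b M z cz))

mainTheorem8 : (M : MobiusPlane) (q : ℕ) → HasOrder M q →
    (B : Subset (n M)) → IsMinimumBlockingSet M B →
    ((+ (∣ B ∣ * (q + 1))) / suc (q * q)) <1+log ((+ (q * (q + 1))) / 1)
mainTheorem8 M zero          order _ _ = contradiction (order≥2 M order) λ ()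
mainTheorem8 M (suc zero)    order _ _ = contradiction (order≥2 M order) λ { (s≤s ()) }
mainTheorem8 M (suc (suc t)) order B minimum =
  ≤harmonic⇒<1+log (pred (pred r)) (a/b≤c/d 0 1 (∣ B ∣ * (q + 1)) (suc (q * q)) z≤n) (begin
    + (∣ B ∣ * (q + 1)) / suc (q * q)
      ≤⟨ a/b≤c/d (∣ B ∣ * (q + 1)) (suc (q * q)) (harmonicNumerator r) (r !) (minimum-blocking-set-≤ minimum) ⟩
    + harmonicNumerator r / r !
      ≡⟨ harmonic≡harmonicNumerator/! r ⟨
    harmonic r ∎)
  where
  open Counting M t order
  open ℚP.≤-Reasoning
  -- r = q (q + 1) reduces to 2 + pred (pred r), as q = 2 + t.
  r : ℕ
  r = q * (q + 1)
  instance
    r!≢0 : NonZero (r !)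
    r!≢0 = r ℕP.!≢0
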